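{- Consider the synchronous self-jamming singing protocol on a dynamic network, and any configuration of the state of the protocol during round $i$. Let $X\subseteq{\cal V}_i$ and let $N(X)$ be the union of the neighbors of agents of $X$ in the network. Suppose the network induced by $X\cup N(X)$ does not change at the beginning of round $i+1$, and the agents in $X\cup N(X)$ execute the protocol correctly at the end of round $i$. Let $p_X$ be the probability that in round $i+1$ no agent of $X$ is in state $\textsc{In}$. Then the probability that $X$ has at least one agent that is $\textsc{In}^{\overline{\textsc{In}}}$ in round $i+1$ is at least $(1-p_X)/2$.
   Context: Agents are the vertices of an undirected communication graph; agents know nothing about the graph. Each agent is in one of three states $\{\textsc{Out},\textsc{In},\textsc{Un}\}$ and operates in synchronous rounds (all rounds start and end simultaneously; every note sung in a round is heard by all neighbors by the end of the round). Self-jamming communication: an agent hears the union of notes sung by its neighbors except the notes it sings itself (presence only, not multiplicity). Self-jamming singing protocol (one round, agent in state $s$): compute a fresh $\ell$-value by flipping a fair coin until the first $0$, $\ell$ = number of flips (independent across agents and rounds). If $s=\textsc{Out}$: sing nothing, listen for note $0$. If $s=\textsc{In}$: sing even notes $0,2,\dots,2\ell-2$, listen for note $2\ell$. If $s=\textsc{Un}$: sing odd notes $1,3,\dots,2\ell-1$, listen for notes $0$ and $2\ell+1$. End of round: $\textsc{In}$ becomes $\textsc{Un}$ if it heard note $2\ell$, else stays $\textsc{In}$; $\textsc{Un}$ becomes $\textsc{Out}$ if it heard $0$, otherwise stays $\textsc{Un}$ if it heard $2\ell+1$ and becomes $\textsc{In}$ if not; $\textsc{Out}$ stays $\textsc{Out}$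 if it heard $0$, else becomes $\textsc{Un}$. Dynamic networks: agents and edges may be inserted or deleted at the beginning of rounds; new agents start in arbitrary states. An agent is $\textsc{In}^{\overline{\textsc{In}}}$ in a round if it is $\textsc{In}$ and has no $\textsc{In}$ neighbor in that round. An agent is eliminated in round $i$ if it is $\textsc{In}^{\overline{\textsc{In}}}$ or adjacent to an $\textsc{In}^{\overline{\textsc{In}}}$ agent in round $i$; otherwise it is active. ${\cal V}_i$ is the set of active agents in round $i$. The probabilities are over the $\ell$-values chosen in round $i$. -}

module Defs where

open import Data.Nat using (ℕ; zero; suc; _+_; _*_; _<ᵇ_; _≡ᵇ_; _%_)
open import Data.Bool using (Bool; true; false; _∧_; _∨_; not; if_then_else_)
open import Data.Fin using (Fin)
open import Data.Vec using (Vec; []; _∷_; lookup)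
import Data.Vec as Vec
open import Data.List using (List; []; _∷_; map; concatMap; upTo; allFin; foldr)
open import Data.Bool.ListAction using (any; all)
open import Data.Rational using (ℚ; 0ℚ; 1ℚ; ½) renaming (_+_ to _+ℚ_; _*_ to _*ℚ_)
open import Relation.Binary.PropositionalEquality using (_≡_)

data St : Set where
  OUT IN UN : St

isIN : St → Bool
isIN IN = true
isIN _  = false

-- A network snapshot on agents Fin n: a Boolean adjacency relation
-- (absent agents are isolated vertices).
Adj : ℕ → Set
Adj n = Fin n → Fin n → Bool

Symmetric : ∀ {n} → Adj n → Set
Symmetric G = ∀ u v → G u v ≡ G v u

Irreflexive : ∀ {n} → Adj n → Set
Irreflexive G = ∀ v → G v v ≡ false

Subset : ℕ → Set
Subset n = Fin n → Bool

nbrs : ∀ {n} → Adj n → Subset n → Subset n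
nbrs {n} G X v = any (λ u → X u ∧ G u v) (allFin n)

closedNbhd : ∀ {n} → Adj n → Subset n → Subset n
closedNbhd G X v = X v ∨ nbrs G X v

inNotIn : ∀ {n} → Adj n → (Fin n → St) → Fin n → Bool
inNotIn {n} G s v = isIN (s v) ∧ not (any (λ u → G v u ∧ isIN (s u)) (allFin n))

eliminated : ∀ {n} → Adj n → (Fin n → St) → Fin n → Bool
eliminated {n} G s v = inNotIn G s v ∨ any (λ u → G v u ∧ inNotIn G s u) (allFin n)

active : ∀ {n} → Adj n → (Fin n → St) → Fin n → Bool
active G s v = not (eliminated G s v)

isEven : ℕ → Bool
isEven k = (k % 2) ≡ᵇ 0

protoSing : St → ℕ → ℕ → Bool
protoSing OUT l note = false
protoSing IN  l note = isEven note ∧ (note <ᵇ 2 * l)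
protoSing UN  l note = not (isEven note) ∧ (note <ᵇ 2 * l)

-- Round i:  G network, s states, X the set, ext the (arbitrary) singing
-- behaviour of agents outside X ∪ N(X) as a function of their own ℓ-value,
-- lv the vector of ℓ-values of all agents chosen in round i.
module Round {n : ℕ} (G : Adj n) (s : Fin n → St) (X : Subset n)
               (ext : Fin n → ℕ → ℕ → Bool) (lv : Vec ℕ n) where

  ℓ : Fin n → ℕ
  ℓ v = lookup lv v

  sings : Fin n → ℕ → Bool
  sings v note = if closedNbhd G X v then protoSing (s v) (ℓ v) note
                                     else ext v (ℓ v) note

  hears : Fin n → ℕ → Bool
  hears v note = any (λ u → G v u ∧ sings u note) (allFin n) ∧ not (sings v note)

  next : Fin n → St
  next v with s v
  ... | IN  = if hears v (2 * ℓ v) then UN else IN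
  ... | UN  = if hears v 0 then OUT else (if hears v (2 * ℓ v + 1) then UN else IN)
  ... | OUT = if hears v 0 then OUT else UN

  -- (only the states of X ∪ N(X) are used below; these agents are the ones
  --  executing the transition correctly)

  eventA : Adj n → Bool
  eventA G' = any (λ x → X x ∧ inNotIn G' next x) (allFin n)

  eventB : Bool
  eventB = all (λ x → not (X x ∧ isIN (next x))) (allFin n)

-- Probability over independent geometric ℓ-values, P(ℓ_v = k) = 2^{-k}, k ≥ 1.

half^ : ℕ → ℚ
half^ zero    = 1ℚ
half^ (suc k) = ½ *ℚ half^ k

sumℚ : List ℚ → ℚ
sumℚ = foldr _+ℚ_ 0ℚ

box : (n K : ℕ) → List (Vec ℕ n)
box zero    K = [] ∷ []
box (suc n) K = concatMap (λ v → map (λ k → suc k ∷ v) (upTo K)) (box n K)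

-- probability of the event E restricted to the box {1..K}^n;
-- the probability Pr[E] is the (monotone) limit / supremum of these as K → ∞
boxProb : ∀ {n} → ℕ → (Vec ℕ n → Bool) → ℚ
boxProb {n} K E = sumℚ (map (λ lv → if E lv then half^ (Vec.sum lv) else 0ℚ) (box n K))

module Submission where

-- Sample the ℓ-values from the box {1,…,K}ⁿ with K = m + n + 1. Call x a candidate if x ∈ X, x is IN
-- (or UN with no IN neighbour), and ℓ(x) is maximal among its neighbours in the same state. An agent of
-- X can only be IN in round i+1 if it is a candidate; conversely, a candidate whose ℓ-value is strictly
-- maximal is IN with no IN neighbour in round i+1. Incrementing the ℓ-value of the first candidate makes
-- it strictly maximal and keeps it the first candidate, so this map is injective and halves the weight
-- 2^(-Σℓ); hence ½ Pr[some candidate] ≤ Pr[A]. Requiring all ℓ-values below K keeps the image inside the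
-- box and costs at most 2^(-m).

open import Defs
open import Data.Bool using (Bool; true; false; T; not; _∧_; if_then_else_)
open import Data.Bool.ListAction using (any; all)
open import Data.Bool.Properties using (T-≡; T-∧; T-∨)
open import Data.Empty using (⊥-elim)
open import Data.Fin using (Fin) renaming (zero to fzero; suc to fsuc)
import Data.Fin.Properties as Fin
open import Data.Integer using (+≤+)
open import Data.List using (List; []; _∷_; _++_; map; concatMap; upTo; allFin)
open import Data.List.Membership.Propositional using (_∈_; find; lose)
open import Data.List.Membership.Propositional.Properties
  using (∈-∃++; ∈-++⁻; ∈-++⁺ˡ; ∈-++⁺ʳ; ∈-map⁺; ∈-map⁻; ∈-concatMap⁺; ∈-concatMap⁻;
         ∈-upTo⁺; ∈-upTo⁻)
open import Data.List.Properties using (upTo-∷ʳ)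
open import Data.List.Relation.Unary.All using ([]; _∷_)
import Data.List.Relation.Unary.All as All
import Data.List.Relation.Unary.All.Properties as All
open import Data.List.Relation.Unary.AllPairs using ([]; _∷_)
open import Data.List.Relation.Unary.Any using (here; there)
import Data.List.Relation.Unary.Any.Properties as Any
open import Data.List.Relation.Unary.Unique.Propositional using (Unique)
open import Data.List.Relation.Unary.Unique.Propositional.Properties using (++⁺; map⁺; upTo⁺)
open import Data.Maybe as Maybe using (Maybe; just; nothing)
open import Data.Maybe.Properties using (just-injective)
open import Data.Nat as ℕ using (ℕ; zero; suc; z≤n; s≤s)
open import Data.Nat.DivMod using (m*n%n≡0; [m+kn]%n≡m%n)
import Data.Nat.Properties as ℕ
open import Data.Product using (∃; _,_; _×_; proj₁; proj₂)
open import Data.Rational using (*≤*; nonNegative; ℚ; 0ℚ; 1ℚ; ½; _≤_; _+_; _-_; _*_; -_)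
open import Data.Rational.Properties
open import Data.Rational.Solver using (module +-*-Solver)
open +-*-Solver using (solve; _:+_; _:*_; _:-_; _:=_; con)
open import Data.Sum using (_⊎_; inj₁; inj₂)
open import Data.Unit using (tt)
open import Data.Vec as Vec using (Vec; []; _∷_; lookup; _[_]%=_)
import Data.Vec.Properties as Vec
open import Function using (_∘_; _⇔_; mk⇔)
open import Function.Bundles using (module Equivalence)
open Equivalence using (to; from)
open import Function.Construct.Composition using (_⇔-∘_)
open import Relation.Binary.Definitions using (DecidableEquality)
open import Relation.Binary.PropositionalEquality
open import Relation.Nullary using (¬_; T?; Dec; yes; no; ¬?; _×-dec_; _⊎-dec_; _→-dec_)
open import Relation.Nullary.Decidable using (⌊_⌋; toWitness; fromWitness)

∑ : {A : Set} → (A → ℚ) → List A → ℚ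
∑ f xs = sumℚ (map f xs)

module _ {A : Set} where

  ∑-++ : ∀ (f : A → ℚ) xs ys → ∑ f (xs ++ ys) ≡ ∑ f xs + ∑ f ys
  ∑-++ f []       ys = sym (+-identityˡ _)
  ∑-++ f (x ∷ xs) ys = trans (cong (f x +_) (∑-++ f xs ys)) (sym (+-assoc (f x) _ _))

  ∑-cong : ∀ {f g : A → ℚ} xs → (∀ {x} → x ∈ xs → f x ≡ g x) → ∑ f xs ≡ ∑ g xs
  ∑-cong []       f≡g = refl
  ∑-cong (x ∷ xs) f≡g = cong₂ _+_ (f≡g (here refl)) (∑-cong xs (λ x∈ → f≡g (there x∈)))

  ∑-mono-≤ : ∀ {f g : A → ℚ} xs → (∀ {x} → x ∈ xs → f x ≤ g x) → ∑ f xs ≤ ∑ g xs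
  ∑-mono-≤ []       f≤g = ≤-refl
  ∑-mono-≤ (x ∷ xs) f≤g = +-mono-≤ (f≤g (here refl)) (∑-mono-≤ xs (λ x∈ → f≤g (there x∈)))

  ∑-nonNeg : ∀ {f : A → ℚ} xs → (∀ x → 0ℚ ≤ f x) → 0ℚ ≤ ∑ f xs
  ∑-nonNeg []       f≥0 = ≤-refl
  ∑-nonNeg (x ∷ xs) f≥0 = ≤-trans (≤-reflexive (sym (+-identityˡ 0ℚ))) (+-mono-≤ (f≥0 x) (∑-nonNeg xs f≥0))

  ∑-+ : ∀ (f g : A → ℚ) xs → ∑ (λ x → f x + g x) xs ≡ ∑ f xs + ∑ g xs
  ∑-+ f g []       = sym (+-identityˡ 0ℚ)
  ∑-+ f g (x ∷ xs) = trans (cong (f x + g x +_) (∑-+ f g xs))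
    (solve 4 (λ a b c d → (a :+ b) :+ (c :+ d) := (a :+ c) :+ (b :+ d)) refl (f x) (g x) (∑ f xs) (∑ g xs))

  ∑-*ˡ : ∀ c (f : A → ℚ) xs → ∑ (λ x → c * f x) xs ≡ c * ∑ f xs
  ∑-*ˡ c f []       = sym (*-zeroʳ c)
  ∑-*ˡ c f (x ∷ xs) = trans (cong (c * f x +_) (∑-*ˡ c f xs)) (sym (*-distribˡ-+ c (f x) _))

  ∑-*ʳ : ∀ c (f : A → ℚ) xs → ∑ (λ x → f x * c) xs ≡ ∑ f xs * c
  ∑-*ʳ c f []       = sym (*-zeroˡ c)
  ∑-*ʳ c f (x ∷ xs) = trans (cong (f x * c +_) (∑-*ʳ c f xs)) (sym (*-distribʳ-+ c (f x) _))

  ∑-insert : ∀ (f : A → ℚ) ys₁ y ys₂ → ∑ f (ys₁ ++ y ∷ ys₂) ≡ f y + ∑ f (ys₁ ++ ys₂)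
  ∑-insert f ys₁ y ys₂ = begin
    ∑ f (ys₁ ++ y ∷ ys₂)           ≡⟨ ∑-++ f ys₁ (y ∷ ys₂) ⟩
    ∑ f ys₁ + (f y + ∑ f ys₂)
      ≡⟨ solve 3 (λ a b c → a :+ (b :+ c) := b :+ (a :+ c)) refl (∑ f ys₁) (f y) (∑ f ys₂) ⟩
    f y + (∑ f ys₁ + ∑ f ys₂)      ≡⟨ cong (f y +_) (sym (∑-++ f ys₁ ys₂)) ⟩
    f y + ∑ f (ys₁ ++ ys₂)         ∎
    where open ≡-Reasoning

module _ {A B : Set} where

  ∑-map : ∀ (f : B → ℚ) (g : A → B) xs → ∑ f (map g xs) ≡ ∑ (λ x → f (g x)) xs
  ∑-map f g []       = refl
  ∑-map f g (x ∷ xs) = cong (f (g x) +_) (∑-map f g xs)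

  ∑-concatMap : ∀ (f : B → ℚ) (g : A → List B) xs →
                ∑ f (concatMap g xs) ≡ ∑ (λ x → ∑ f (g x)) xs
  ∑-concatMap f g []       = refl
  ∑-concatMap f g (x ∷ xs) =
    trans (∑-++ f (g x) (concatMap g xs)) (cong (∑ f (g x) +_) (∑-concatMap f g xs))

∈-++-∷⁻ : ∀ {A : Set} {y z : A} ys₁ {ys₂} → y ∈ ys₁ ++ z ∷ ys₂ → y ≢ z → y ∈ ys₁ ++ ys₂
∈-++-∷⁻ ys₁ y∈ y≢z with ∈-++⁻ ys₁ y∈
... | inj₁ y∈₁          = ∈-++⁺ˡ y∈₁
... | inj₂ (here y≡z)   = ⊥-elim (y≢z y≡z)
... | inj₂ (there y∈₂)  = ∈-++⁺ʳ ys₁ y∈₂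

module _ {A B : Set} (h : B → ℚ) (h≥0 : ∀ y → 0ℚ ≤ h y) (E : A → Bool) (φ : A → B) where

  ∑-≤-injective : ∀ {xs ys} → Unique xs →
    (∀ {x} → x ∈ xs → T (E x) → φ x ∈ ys) →
    (∀ {x x′} → x ∈ xs → x′ ∈ xs → T (E x) → T (E x′) → φ x ≡ φ x′ → x ≡ x′) →
    ∑ (λ x → if E x then h (φ x) else 0ℚ) xs ≤ ∑ h ys
  ∑-≤-injective {[]}     {ys} _ _ _ = ∑-nonNeg ys h≥0
  ∑-≤-injective {x ∷ xs} {ys} (x∉xs ∷ xs!) φ∈ φ-inj with E x in Ex
  ... | false = ≤-trans (≤-reflexive (+-identityˡ _))
                  (∑-≤-injective xs! (λ x∈ → φ∈ (there x∈)) (λ y∈ y′∈ → φ-inj (there y∈) (there y′∈)))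
  ... | true with ys₁ , ys₂ , refl ← ∈-∃++ (φ∈ (here refl) (from T-≡ Ex)) = begin
    h (φ x) + ∑ (λ x → if E x then h (φ x) else 0ℚ) xs  ≤⟨ +-monoʳ-≤ (h (φ x)) rest ⟩
    h (φ x) + ∑ h (ys₁ ++ ys₂)                          ≡⟨ sym (∑-insert h ys₁ (φ x) ys₂) ⟩
    ∑ h (ys₁ ++ φ x ∷ ys₂)                              ∎
    where
    open ≤-Reasoning
    φ∉ : ∀ {y} → y ∈ xs → T (E y) → φ y ≢ φ x
    φ∉ y∈ Ey φy≡φx = All.lookup x∉xs y∈ (sym (φ-inj (there y∈) (here refl) Ey (from T-≡ Ex) φy≡φx))
    rest : ∑ (λ x → if E x then h (φ x) else 0ℚ) xs ≤ ∑ h (ys₁ ++ ys₂)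
    rest = ∑-≤-injective xs! (λ y∈ Ey → ∈-++-∷⁻ ys₁ (φ∈ (there y∈) Ey) (φ∉ y∈ Ey))
                             (λ y∈ y′∈ → φ-inj (there y∈) (there y′∈))

*-nonNeg : ∀ {p q} → 0ℚ ≤ p → 0ℚ ≤ q → 0ℚ ≤ p * q
*-nonNeg {p} p≥0 q≥0 = ≤-trans (≤-reflexive (sym (*-zeroʳ p))) (*-monoˡ-≤-nonNeg p {{nonNegative p≥0}} q≥0)

p-q≤p : ∀ p {q} → 0ℚ ≤ q → p - q ≤ p
p-q≤p p q≥0 = ≤-trans (+-monoʳ-≤ p (neg-antimono-≤ q≥0)) (≤-reflexive (+-identityʳ p))

half^-nonNeg : ∀ k → 0ℚ ≤ half^ k
half^-nonNeg zero    = *≤* (+≤+ z≤n)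
half^-nonNeg (suc k) = *-monoˡ-≤-nonNeg ½ (half^-nonNeg k)

half^-+ : ∀ a b → half^ (a ℕ.+ b) ≡ half^ a * half^ b
half^-+ zero    b = sym (*-identityˡ (half^ b))
half^-+ (suc a) b = trans (cong (½ *_) (half^-+ a b)) (sym (*-assoc ½ (half^ a) (half^ b)))

half^-≤-1 : ∀ k → half^ k ≤ 1ℚ
half^-≤-1 zero    = ≤-refl
half^-≤-1 (suc k) = ≤-trans (*-monoˡ-≤-nonNeg ½ (half^-≤-1 k)) (*≤* (+≤+ (s≤s z≤n)))

half^-+-≤ : ∀ m n → half^ (m ℕ.+ n) ≤ half^ m
half^-+-≤ m n = begin
  half^ (m ℕ.+ n)       ≡⟨ half^-+ m n ⟩
  half^ m * half^ n     ≤⟨ *-monoˡ-≤-nonNeg (half^ m) {{nonNegative (half^-nonNeg m)}} (half^-≤-1 n) ⟩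
  half^ m * 1ℚ          ≡⟨ *-identityʳ (half^ m) ⟩
  half^ m               ∎
  where open ≤-Reasoning

half^-suc-≤ : ∀ k → half^ (suc k) ≤ half^ k
half^-suc-≤ k = subst (λ j → half^ j ≤ half^ k) (ℕ.+-comm k 1) (half^-+-≤ k 1)

∑-upTo-suc : ∀ (f : ℕ → ℚ) K → ∑ f (upTo (suc K)) ≡ ∑ f (upTo K) + f K
∑-upTo-suc f K = begin
  ∑ f (upTo (suc K))           ≡⟨ cong (∑ f) (sym (upTo-∷ʳ K)) ⟩
  ∑ f (upTo K ++ K ∷ [])       ≡⟨ ∑-++ f (upTo K) (K ∷ []) ⟩
  ∑ f (upTo K) + (f K + 0ℚ)    ≡⟨ cong (∑ f (upTo K) +_) (+-identityʳ (f K)) ⟩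
  ∑ f (upTo K) + f K           ∎
  where open ≡-Reasoning

geometric-sum : ∀ K → ∑ (λ k → half^ (suc k)) (upTo K) ≡ 1ℚ - half^ K
geometric-sum zero    = sym (+-inverseʳ 1ℚ)
geometric-sum (suc K) = begin
  ∑ (λ k → half^ (suc k)) (upTo (suc K))               ≡⟨ ∑-upTo-suc (λ k → half^ (suc k)) K ⟩
  ∑ (λ k → half^ (suc k)) (upTo K) + ½ * half^ K       ≡⟨ cong (_+ ½ * half^ K) (geometric-sum K) ⟩
  1ℚ - half^ K + ½ * half^ K
    ≡⟨ solve 1 (λ h → con 1ℚ :- h :+ con ½ :* h := con 1ℚ :- con ½ :* h) refl (half^ K) ⟩
  1ℚ - half^ (suc K)                                   ∎
  where open ≡-Reasoning

InBox : ∀ {n} → ℕ → Vec ℕ n → Set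
InBox K ω = ∀ i → 0 ℕ.< lookup ω i × lookup ω i ℕ.≤ K

extensions : ∀ {n} → ℕ → Vec ℕ n → List (Vec ℕ (suc n))
extensions K v = map (λ k → suc k ∷ v) (upTo K)

∈-box⁻ : ∀ {n K ω} → ω ∈ box n K → InBox K ω
∈-box⁻ {zero}  {ω = []} _ ()
∈-box⁻ {suc n} {K} ω∈ i
  with v , v∈ , ω∈ext ← find (∈-concatMap⁻ (extensions K) {xs = box n K} ω∈)
  with k , k∈ , refl ← ∈-map⁻ (λ k → suc k ∷ v) ω∈ext
  with i
... | fzero  = s≤s z≤n , ∈-upTo⁻ k∈
... | fsuc j = ∈-box⁻ v∈ j

∈-box⁺ : ∀ {n K ω} → InBox K ω → ω ∈ box n K
∈-box⁺ {zero}  {ω = []} _ = here refl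
∈-box⁺ {suc n} {ω = zero ∷ v} inBox with () ← proj₁ (inBox fzero)
∈-box⁺ {suc n} {K} {suc k ∷ v} inBox =
  ∈-concatMap⁺ (extensions K) {xs = box n K}
    (lose (∈-box⁺ (λ j → inBox (fsuc j))) (∈-map⁺ (λ k → suc k ∷ v) (∈-upTo⁺ (proj₂ (inBox fzero)))))

box-unique : ∀ n K → Unique (box n K)
box-unique zero    K = [] ∷ []
box-unique (suc n) K = extensions-unique (box n K) (box-unique n K)
  where
  tail-∈-extensions : ∀ {v w} → w ∈ extensions K v → Vec.tail w ≡ v
  tail-∈-extensions {v} w∈ with _ , _ , refl ← ∈-map⁻ (λ k → suc k ∷ v) w∈ = refl

  extensions-unique : ∀ vs → Unique vs → Unique (concatMap (extensions K) vs)
  extensions-unique []       _            = []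
  extensions-unique (v ∷ vs) (v∉vs ∷ vs!) =
    ++⁺ (map⁺ (λ { refl → refl }) (upTo⁺ K)) (extensions-unique vs vs!) disjoint
    where
    disjoint : ∀ {w} → ¬ (w ∈ extensions K v × w ∈ concatMap (extensions K) vs)
    disjoint (w∈ , w∈′) with v′ , v′∈ , w∈ext′ ← find (∈-concatMap⁻ (extensions K) {xs = vs} w∈′) =
      All.lookup v∉vs v′∈ (trans (sym (tail-∈-extensions w∈)) (tail-∈-extensions w∈ext′))

InBox-updateAt-suc : ∀ {n K} {ω : Vec ℕ n} {x} → InBox K ω → lookup ω x ℕ.< K → InBox K (ω [ x ]%= suc)
InBox-updateAt-suc {ω = ω} {x} inBox ωx<K i with i Fin.≟ x
... | yes refl rewrite Vec.lookup∘updateAt i {suc} ω = s≤s z≤n , ωx<K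
... | no i≢x   rewrite Vec.lookup∘updateAt′ i x {suc} i≢x ω = inBox i

mass : ∀ {n} → (Vec ℕ n → Bool) → Vec ℕ n → ℚ
mass E ω = if E ω then half^ (Vec.sum ω) else 0ℚ

mass-nonNeg : ∀ {n} (E : Vec ℕ n → Bool) ω → 0ℚ ≤ mass E ω
mass-nonNeg E ω with E ω
... | true  = half^-nonNeg (Vec.sum ω)
... | false = ≤-refl

boxProb-nonNeg : ∀ {n} K (E : Vec ℕ n → Bool) → 0ℚ ≤ boxProb K E
boxProb-nonNeg {n} K E = ∑-nonNeg (box n K) (mass-nonNeg E)

boxProb-∪ : ∀ {n} K (E E₁ E₂ : Vec ℕ n → Bool) →
  (∀ {ω} → ω ∈ box n K → T (E ω) → T (E₁ ω) ⊎ T (E₂ ω)) →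
  boxProb K E ≤ boxProb K E₁ + boxProb K E₂
boxProb-∪ {n} K E E₁ E₂ E⊆E₁∪E₂ = begin
  ∑ (mass E) (box n K)                           ≤⟨ ∑-mono-≤ (box n K) (λ ω∈ → pointwise _ (E⊆E₁∪E₂ ω∈)) ⟩
  ∑ (λ ω → mass E₁ ω + mass E₂ ω) (box n K)      ≡⟨ ∑-+ (mass E₁) (mass E₂) (box n K) ⟩
  ∑ (mass E₁) (box n K) + ∑ (mass E₂) (box n K)  ∎
  where
  open ≤-Reasoning
  pointwise : ∀ ω → (T (E ω) → T (E₁ ω) ⊎ T (E₂ ω)) → mass E ω ≤ mass E₁ ω + mass E₂ ω
  pointwise ω E⇒ with E ω | E₁ ω | E₂ ω | E⇒
  ... | false | b | c | _ = +-mono-≤ (mass-nonNeg (λ _ → b) ω) (mass-nonNeg (λ _ → c) ω)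
  ... | true  | true  | c | _ =
    ≤-trans (≤-reflexive (sym (+-identityʳ _))) (+-monoʳ-≤ (half^ (Vec.sum ω)) (mass-nonNeg (λ _ → c) ω))
  ... | true  | false | true  | _ = ≤-reflexive (sym (+-identityˡ _))
  ... | true  | false | false | E⇒′ with E⇒′ _
  ...   | inj₁ ()
  ...   | inj₂ ()

boxProb-halving : ∀ {n} K (E F : Vec ℕ n → Bool) (φ : Vec ℕ n → Vec ℕ n) →
  (∀ {ω} → ω ∈ box n K → T (E ω) →
     φ ω ∈ box n K × T (F (φ ω)) × Vec.sum (φ ω) ≡ suc (Vec.sum ω)) →
  (∀ {ω ω′} → ω ∈ box n K → ω′ ∈ box n K → T (E ω) → T (E ω′) → φ ω ≡ φ ω′ → ω ≡ ω′) →
  ½ * boxProb K E ≤ boxProb K F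
boxProb-halving {n} K E F φ φ-maps φ-inj = begin
  ½ * ∑ (mass E) (box n K)
    ≡⟨ sym (∑-*ˡ ½ (mass E) (box n K)) ⟩
  ∑ (λ ω → ½ * mass E ω) (box n K)
    ≡⟨ ∑-cong (box n K) (λ ω∈ → pointwise _ (φ-maps ω∈)) ⟩
  ∑ (λ ω → if E ω then mass F (φ ω) else 0ℚ) (box n K)
    ≤⟨ ∑-≤-injective (mass F) (mass-nonNeg F) E φ (box-unique n K) (λ ω∈ Eω → proj₁ (φ-maps ω∈ Eω)) φ-inj ⟩
  ∑ (mass F) (box n K)
    ∎
  where
  open ≤-Reasoning
  pointwise : ∀ ω → (T (E ω) → φ ω ∈ box n K × T (F (φ ω)) × Vec.sum (φ ω) ≡ suc (Vec.sum ω)) →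
              ½ * mass E ω ≡ (if E ω then mass F (φ ω) else 0ℚ)
  pointwise ω E⇒ with E ω | E⇒
  ... | false | _  = *-zeroʳ ½
  ... | true  | E⇒′ with F (φ ω) | E⇒′ _
  ...   | true | _ , _ , sum-φ = cong half^ (sym sum-φ)

<ᵇ-irrefl : ∀ k → (k ℕ.<ᵇ k) ≡ false
<ᵇ-irrefl zero    = refl
<ᵇ-irrefl (suc k) = <ᵇ-irrefl k

below : ∀ {n} → ℕ → Vec ℕ n → Bool
below K []      = true
below K (k ∷ ω) = (k ℕ.<ᵇ K) ∧ below K ω

below⇒< : ∀ {n K} {ω : Vec ℕ n} → T (below K ω) → ∀ i → lookup ω i ℕ.< K
below⇒< {K = K} {k ∷ ω} t fzero    = ℕ.<ᵇ⇒< k K (proj₁ (to T-∧ t))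
below⇒< {K = K} {k ∷ ω} t (fsuc i) = below⇒< {ω = ω} (proj₂ (to (T-∧ {k ℕ.<ᵇ K}) t)) i

boxProb-below-suc : ∀ n K →
  boxProb {suc n} (suc K) (below (suc K)) ≡ (1ℚ - half^ K) * boxProb {n} (suc K) (below (suc K))
boxProb-below-suc n K = begin
  ∑ (mass Below) (concatMap (extensions (suc K)) (box n (suc K)))
    ≡⟨ ∑-concatMap (mass Below) (extensions (suc K)) (box n (suc K)) ⟩
  ∑ (λ v → ∑ (mass Below) (extensions (suc K) v)) (box n (suc K))
    ≡⟨ ∑-cong (box n (suc K)) (λ {v} _ → factor v) ⟩
  ∑ (λ v → (1ℚ - half^ K) * mass Below v) (box n (suc K))
    ≡⟨ ∑-*ˡ (1ℚ - half^ K) (mass Below) (box n (suc K)) ⟩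
  (1ℚ - half^ K) * ∑ (mass Below) (box n (suc K))    ∎
  where
  open ≡-Reasoning
  Below : ∀ {m} → Vec ℕ m → Bool
  Below = below (suc K)

  g : ℕ → ℚ
  g k = if k ℕ.<ᵇ K then half^ (suc k) else 0ℚ

  g-K : g K ≡ 0ℚ
  g-K rewrite <ᵇ-irrefl K = refl

  g-< : ∀ {k} → k ℕ.< K → g k ≡ half^ (suc k)
  g-< k<K rewrite to T-≡ (ℕ.<⇒<ᵇ k<K) = refl

  ∑g : ∑ g (upTo (suc K)) ≡ 1ℚ - half^ K
  ∑g = begin
    ∑ g (upTo (suc K))                 ≡⟨ ∑-upTo-suc g K ⟩
    ∑ g (upTo K) + g K                 ≡⟨ cong (∑ g (upTo K) +_) g-K ⟩
    ∑ g (upTo K) + 0ℚ                  ≡⟨ +-identityʳ _ ⟩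
    ∑ g (upTo K)                       ≡⟨ ∑-cong (upTo K) (λ k∈ → g-< (∈-upTo⁻ k∈)) ⟩
    ∑ (λ k → half^ (suc k)) (upTo K)   ≡⟨ geometric-sum K ⟩
    1ℚ - half^ K                       ∎

  factor : ∀ v → ∑ (mass Below) (extensions (suc K) v) ≡ (1ℚ - half^ K) * mass Below v
  factor v = begin
    ∑ (mass Below) (map (λ k → suc k ∷ v) (upTo (suc K)))
      ≡⟨ ∑-map (mass Below) (λ k → suc k ∷ v) (upTo (suc K)) ⟩
    ∑ (λ k → mass Below (suc k ∷ v)) (upTo (suc K))        ≡⟨ ∑-cong (upTo (suc K)) (λ {k} _ → split k) ⟩
    ∑ (λ k → g k * mass Below v) (upTo (suc K))           ≡⟨ ∑-*ʳ (mass Below v) g (upTo (suc K)) ⟩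
    ∑ g (upTo (suc K)) * mass Below v                     ≡⟨ cong (_* mass Below v) ∑g ⟩
    (1ℚ - half^ K) * mass Below v                         ∎
    where
    split : ∀ k → mass Below (suc k ∷ v) ≡ g k * mass Below v
    split k with k ℕ.<ᵇ K | Below v
    ... | true  | true  = half^-+ (suc k) (Vec.sum v)
    ... | true  | false = sym (*-zeroʳ (half^ (suc k)))
    ... | false | b     = sym (*-zeroˡ (mass (λ _ → b) v))

boxProb-below-≤-1 : ∀ n K → boxProb {n} (suc K) (below (suc K)) ≤ 1ℚ
boxProb-below-≤-1 zero    K = ≤-reflexive (+-identityʳ 1ℚ)
boxProb-below-≤-1 (suc n) K = begin
  boxProb {suc n} (suc K) (below (suc K)) ≡⟨ boxProb-below-suc n K ⟩
  (1ℚ - half^ K) * q                  ≡⟨ solve 2 (λ t q → (con 1ℚ :- t) :* q := q :- t :* q) refl (half^ K) q ⟩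
  q - half^ K * q                     ≤⟨ p-q≤p q (*-nonNeg (half^-nonNeg K) q≥0) ⟩
  q                                   ≤⟨ boxProb-below-≤-1 n K ⟩
  1ℚ                                  ∎
  where
  open ≤-Reasoning
  q : ℚ
  q = boxProb {n} (suc K) (below (suc K))
  q≥0 : 0ℚ ≤ q
  q≥0 = boxProb-nonNeg {n} (suc K) (below (suc K))

-- Induction on n with m shifted to suc m: the first coordinate and the remaining n each lose at most half^ (suc m).
boxProb-below-tail : ∀ n m → 1ℚ - boxProb {n} (suc (m ℕ.+ n)) (below (suc (m ℕ.+ n))) ≤ half^ m
boxProb-below-tail zero    m =
  ≤-trans (≤-reflexive (trans (cong (λ q → 1ℚ - q) (+-identityʳ 1ℚ)) (+-inverseʳ 1ℚ))) (half^-nonNeg m)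
boxProb-below-tail (suc n) m rewrite ℕ.+-suc m n = begin
  1ℚ - boxProb {suc n} (suc K) (below (suc K))     ≡⟨ cong (λ q → 1ℚ - q) (boxProb-below-suc n K) ⟩
  1ℚ - (1ℚ - t) * q
    ≡⟨ solve 2 (λ t q → con 1ℚ :- (con 1ℚ :- t) :* q := (con 1ℚ :- q) :+ t :* q) refl t q ⟩
  (1ℚ - q) + t * q                                 ≤⟨ +-mono-≤ (boxProb-below-tail n (suc m)) t*q≤ ⟩
  half^ (suc m) + half^ (suc m)                    ≡⟨ solve 1 (λ h → con ½ :* h :+ con ½ :* h := h) refl (half^ m) ⟩
  half^ m                                          ∎
  where
  open ≤-Reasoning
  K : ℕ
  K = suc m ℕ.+ n
  t q : ℚ
  t = half^ K
  q = boxProb {n} (suc K) (below (suc K))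
  t*q≤ : t * q ≤ half^ (suc m)
  t*q≤ = begin
    t * q    ≤⟨ *-monoˡ-≤-nonNeg t {{nonNegative (half^-nonNeg K)}} (boxProb-below-≤-1 n K) ⟩
    t * 1ℚ   ≡⟨ *-identityʳ t ⟩
    t        ≤⟨ half^-+-≤ (suc m) n ⟩
    half^ (suc m) ∎

first : ∀ {m} → (Fin m → Bool) → Maybe (Fin m)
first {zero}  p = nothing
first {suc m} p = if p fzero then just fzero else Maybe.map fsuc (first (λ i → p (fsuc i)))

first-sound : ∀ {m} (p : Fin m → Bool) {x} → first p ≡ just x → T (p x)
first-sound {suc m} p e with p fzero in p0
... | true  with refl ← e = from T-≡ p0
... | false with first (λ i → p (fsuc i)) in e′ | e
...   | just y | refl = first-sound (λ i → p (fsuc i)) e′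

first-complete : ∀ {m} (p : Fin m → Bool) {x} → T (p x) → ∃ λ y → first p ≡ just y
first-complete {suc m} p {x} px with p fzero in p0
... | true = fzero , refl
... | false with x
...   | fzero  = ⊥-elim (subst T p0 px)
...   | fsuc x′ with y , e ← first-complete (λ i → p (fsuc i)) px = fsuc y , cong (Maybe.map fsuc) e

first-transfer : ∀ {m} (p q : Fin m → Bool) {x} → first p ≡ just x → T (q x) →
                 (∀ y → y ≢ x → T (q y) → T (p y)) → first q ≡ just x
first-transfer {suc m} p q {x} e qx q⇒p with p fzero in p0
... | true with refl ← e with q fzero
...   | true  = refl
...   | false = ⊥-elim qx
first-transfer {suc m} p q {x} e qx q⇒p | false
  with first (λ i → p (fsuc i)) in e′ | e
... | just x′ | refl with q fzero in q0
...   | true  = ⊥-elim (subst T p0 (q⇒p fzero (λ ()) (from T-≡ q0)))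
...   | false = cong (Maybe.map fsuc)
                  (first-transfer (λ i → p (fsuc i)) (λ i → q (fsuc i)) e′ qx
                     (λ y y≢x′ qy → q⇒p (fsuc y) (λ e → y≢x′ (Fin.suc-injective e)) qy))

sum-updateAt-suc : ∀ {n} (ω : Vec ℕ n) x → Vec.sum (ω [ x ]%= suc) ≡ suc (Vec.sum ω)
sum-updateAt-suc (k ∷ ω) fzero    = refl
sum-updateAt-suc (k ∷ ω) (fsuc x) = trans (cong (k ℕ.+_) (sum-updateAt-suc ω x)) (ℕ.+-suc k (Vec.sum ω))

updateAt-suc-injective : ∀ {n} (ω ω′ : Vec ℕ n) x → ω [ x ]%= suc ≡ ω′ [ x ]%= suc → ω ≡ ω′
updateAt-suc-injective (k ∷ ω) (k′ ∷ ω′) fzero e with refl , refl ← Vec.∷-injective e = refl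
updateAt-suc-injective (k ∷ ω) (k′ ∷ ω′) (fsuc x) e with refl , e′ ← Vec.∷-injective e =
  cong (k ∷_) (updateAt-suc-injective ω ω′ x e′)

lookup-≤-updateAt-suc : ∀ {n} (ω : Vec ℕ n) x u → lookup ω u ℕ.≤ lookup (ω [ x ]%= suc) u
lookup-≤-updateAt-suc (k ∷ ω) fzero    fzero    = ℕ.n≤1+n k
lookup-≤-updateAt-suc (k ∷ ω) fzero    (fsuc u) = ℕ.≤-refl
lookup-≤-updateAt-suc (k ∷ ω) (fsuc x) fzero    = ℕ.≤-refl
lookup-≤-updateAt-suc (k ∷ ω) (fsuc x) (fsuc u) = lookup-≤-updateAt-suc ω x u

¬T⇒T-not : ∀ {b} → ¬ T b → T (not b)
¬T⇒T-not {false} _  = tt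
¬T⇒T-not {true}  ¬t = ¬t tt

¬T-not⇒T : ∀ {b} → ¬ T (not b) → T b
¬T-not⇒T {false} ¬t = ¬t tt
¬T-not⇒T {true}  _  = tt

module _ {n : ℕ} (p : Fin n → Bool) where

  any-allFin⁺ : ∀ i → T (p i) → T (any p (allFin n))
  any-allFin⁺ i pi = Any.any⁺ p (Any.tabulate⁺ i pi)

  any-allFin⁻ : T (any p (allFin n)) → ∃ λ i → T (p i)
  any-allFin⁻ t = Any.tabulate⁻ (Any.any⁻ p (allFin n) t)

  ¬all-allFin⁻ : ¬ T (all p (allFin n)) → ∃ λ i → ¬ T (p i)
  ¬all-allFin⁻ ¬all =
    Fin.¬∀⟶∃¬ n (λ i → T (p i)) (λ i → T? (p i)) (λ ∀p → ¬all (All.all⁻ p (All.tabulate⁺ ∀p)))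

isIN⇔ : ∀ {st} → T (isIN st) ⇔ st ≡ IN
isIN⇔ {OUT} = mk⇔ (λ ()) (λ ())
isIN⇔ {IN}  = mk⇔ (λ _ → refl) (λ _ → tt)
isIN⇔ {UN}  = mk⇔ (λ ()) (λ ())

_≟ₛ_ : DecidableEquality St
OUT ≟ₛ OUT = yes refl
OUT ≟ₛ IN  = no λ ()
OUT ≟ₛ UN  = no λ ()
IN  ≟ₛ OUT = no λ ()
IN  ≟ₛ IN  = yes refl
IN  ≟ₛ UN  = no λ ()
UN  ≟ₛ OUT = no λ ()
UN  ≟ₛ IN  = no λ ()
UN  ≟ₛ UN  = yes refl

isEven-double : ∀ k → isEven (2 ℕ.* k) ≡ true
isEven-double k = cong (ℕ._≡ᵇ 0) (trans (cong (ℕ._% 2) (ℕ.*-comm 2 k)) (m*n%n≡0 k 2))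

isEven-double+1 : ∀ k → isEven (2 ℕ.* k ℕ.+ 1) ≡ false
isEven-double+1 k = cong (ℕ._≡ᵇ 0) (trans (cong (ℕ._% 2) 2k+1≡1+k*2) ([m+kn]%n≡m%n 1 k 2))
  where
  2k+1≡1+k*2 : 2 ℕ.* k ℕ.+ 1 ≡ 1 ℕ.+ k ℕ.* 2
  2k+1≡1+k*2 = trans (ℕ.+-comm (2 ℕ.* k) 1) (cong (1 ℕ.+_) (ℕ.*-comm 2 k))

<ᵇ⇔< : ∀ {m n} → T (m ℕ.<ᵇ n) ⇔ m ℕ.< n
<ᵇ⇔< {m} {n} = mk⇔ (ℕ.<ᵇ⇒< m n) ℕ.<⇒<ᵇ

double-<-double : ∀ {k l} → 2 ℕ.* k ℕ.< 2 ℕ.* l ⇔ k ℕ.< l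
double-<-double {k} {l} = mk⇔ (ℕ.*-cancelˡ-< 2 k l) (ℕ.*-monoʳ-< 2)

double+1-<-double : ∀ {k l} → 2 ℕ.* k ℕ.+ 1 ℕ.< 2 ℕ.* l ⇔ k ℕ.< l
double+1-<-double {k} {l} = mk⇔ halve double
  where
  halve : 2 ℕ.* k ℕ.+ 1 ℕ.< 2 ℕ.* l → k ℕ.< l
  halve lt = ℕ.*-cancelˡ-< 2 k l (ℕ.<-trans (ℕ.m<m+n (2 ℕ.* k) (s≤s z≤n)) lt)
  double : k ℕ.< l → 2 ℕ.* k ℕ.+ 1 ℕ.< 2 ℕ.* l
  double k<l = begin-strict
    2 ℕ.* k ℕ.+ 1      ≡⟨ ℕ.+-comm (2 ℕ.* k) 1 ⟩
    suc (2 ℕ.* k)      <⟨ ℕ.n<1+n _ ⟩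
    2 ℕ.+ 2 ℕ.* k      ≡⟨ ℕ.*-suc 2 k ⟨
    2 ℕ.* suc k        ≤⟨ ℕ.*-monoʳ-≤ 2 k<l ⟩
    2 ℕ.* l            ∎
    where open ℕ.≤-Reasoning

IN-sings-even : ∀ l k → T (protoSing IN l (2 ℕ.* k)) ⇔ k ℕ.< l
IN-sings-even l k rewrite isEven-double k = double-<-double ⇔-∘ <ᵇ⇔<

UN-sings-odd : ∀ l k → T (protoSing UN l (2 ℕ.* k ℕ.+ 1)) ⇔ k ℕ.< l
UN-sings-odd l k rewrite isEven-double+1 k = double+1-<-double ⇔-∘ <ᵇ⇔<

UN-silent-even : ∀ l k → ¬ T (protoSing UN l (2 ℕ.* k))
UN-silent-even l k rewrite isEven-double k = λ ()

module Protocol {n : ℕ} (G : Adj n) (s : Fin n → St) (X : Subset n) (ext : Fin n → ℕ → ℕ → Bool) where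

  NoINNeighbour : Fin n → Set
  NoINNeighbour x = ∀ u → T (G x u) → s u ≢ IN

  Eligible : Fin n → Set
  Eligible x = s x ≡ IN ⊎ (s x ≡ UN × NoINNeighbour x)

  Dominates : (ℕ → ℕ → Set) → Vec ℕ n → Fin n → Set
  Dominates _≺_ ω x = ∀ u → T (G x u) → s u ≡ s x → lookup ω u ≺ lookup ω x

  Candidate : Vec ℕ n → Fin n → Set
  Candidate ω x = T (X x) × Eligible x × Dominates ℕ._≤_ ω x

  X⊆closedNbhd : ∀ {x} → T (X x) → T (closedNbhd G X x)
  X⊆closedNbhd x∈X = from T-∨ (inj₁ x∈X)

  N⊆closedNbhd : ∀ {x u} → T (X x) → T (G x u) → T (closedNbhd G X u)
  N⊆closedNbhd {x} x∈X xu =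
    from T-∨ (inj₂ (any-allFin⁺ _ x (from T-∧ (x∈X , xu))))

  module _ (ω : Vec ℕ n) where
    open Round G s X ext ω

    sings-by-state : ∀ {v st} note → T (closedNbhd G X v) → s v ≡ st → sings v note ≡ protoSing st (ℓ v) note
    sings-by-state {v} note cl refl rewrite to T-≡ cl = refl

    IN-sings : ∀ {v} → T (closedNbhd G X v) → s v ≡ IN → ∀ k → T (sings v (2 ℕ.* k)) ⇔ k ℕ.< ℓ v
    IN-sings {v} cl sv k rewrite sings-by-state (2 ℕ.* k) cl sv = IN-sings-even (ℓ v) k

    UN-sings : ∀ {v} → T (closedNbhd G X v) → s v ≡ UN → ∀ k → T (sings v (2 ℕ.* k ℕ.+ 1)) ⇔ k ℕ.< ℓ v
    UN-sings {v} cl sv k rewrite sings-by-state (2 ℕ.* k ℕ.+ 1) cl sv = UN-sings-odd (ℓ v) k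

    UN-silent : ∀ {v} → T (closedNbhd G X v) → s v ≡ UN → ∀ k → ¬ T (sings v (2 ℕ.* k))
    UN-silent {v} cl sv k rewrite sings-by-state (2 ℕ.* k) cl sv = UN-silent-even (ℓ v) k

    OUT-silent : ∀ {v} → T (closedNbhd G X v) → s v ≡ OUT → ∀ note → ¬ T (sings v note)
    OUT-silent cl sv note rewrite sings-by-state note cl sv = λ ()

    IN-silent-at-ℓ : ∀ {v} → T (closedNbhd G X v) → s v ≡ IN → ¬ T (sings v (2 ℕ.* ℓ v))
    IN-silent-at-ℓ {v} cl sv t = ℕ.<-irrefl refl (to (IN-sings cl sv (ℓ v)) t)

    UN-silent-at-ℓ : ∀ {v} → T (closedNbhd G X v) → s v ≡ UN → ¬ T (sings v (2 ℕ.* ℓ v ℕ.+ 1))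
    UN-silent-at-ℓ {v} cl sv t = ℕ.<-irrefl refl (to (UN-sings cl sv (ℓ v)) t)

    hears⁺ : ∀ {v u note} → T (G v u) → T (sings u note) → ¬ T (sings v note) → T (hears v note)
    hears⁺ {v} {u} vu su ¬sv =
      from T-∧ (any-allFin⁺ _ u (from T-∧ (vu , su)) , ¬T⇒T-not ¬sv)

    silence : ∀ {v note} → (∀ u → T (G v u) → ¬ T (sings u note)) → ¬ T (hears v note)
    silence silent h
      with u , t ← any-allFin⁻ _ (proj₁ (to T-∧ h))
      with vu , su ← to T-∧ t = silent u vu su

    data NextIN (x : Fin n) : Set where
      stays : s x ≡ IN → ¬ T (hears x (2 ℕ.* ℓ x)) → NextIN x
      joins : s x ≡ UN → ¬ T (hears x 0) → ¬ T (hears x (2 ℕ.* ℓ x ℕ.+ 1)) → NextIN x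

    next≡IN⇔ : ∀ {x} → next x ≡ IN ⇔ NextIN x
    next≡IN⇔ {x} = mk⇔ ⇒NextIN NextIN⇒
      where
      ⇒NextIN : next x ≡ IN → NextIN x
      ⇒NextIN nx with s x in sx
      ⇒NextIN nx | IN with hears x (2 ℕ.* ℓ x) in h
      ⇒NextIN () | IN | true
      ⇒NextIN nx | IN | false = stays sx (subst T h)
      ⇒NextIN nx | UN with hears x 0 in h0 | hears x (2 ℕ.* ℓ x ℕ.+ 1) in h1
      ⇒NextIN () | UN | true  | _
      ⇒NextIN () | UN | false | true
      ⇒NextIN nx | UN | false | false = joins sx (subst T h0) (subst T h1)
      ⇒NextIN nx | OUT with hears x 0
      ⇒NextIN () | OUT | true
      ⇒NextIN () | OUT | false
      NextIN⇒ : NextIN x → next x ≡ IN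
      NextIN⇒ nextIN with s x in sx | nextIN
      ... | IN  | stays _ ¬h with hears x (2 ℕ.* ℓ x)
      ...   | false = refl
      ...   | true  = ⊥-elim (¬h tt)
      NextIN⇒ nextIN | UN | joins _ ¬h0 ¬h1 with hears x 0 | hears x (2 ℕ.* ℓ x ℕ.+ 1)
      ...   | false | false = refl
      ...   | true  | _     = ⊥-elim (¬h0 tt)
      ...   | false | true  = ⊥-elim (¬h1 tt)
      NextIN⇒ nextIN | OUT | stays e _   with () ← trans (sym sx) e
      NextIN⇒ nextIN | OUT | joins e _ _ with () ← trans (sym sx) e
      NextIN⇒ nextIN | IN  | joins e _ _ with () ← trans (sym sx) e
      NextIN⇒ nextIN | UN  | stays e _   with () ← trans (sym sx) e

    nextIN⇒candidate : (∀ i → 0 ℕ.< ℓ i) → ∀ {x} → T (X x) → next x ≡ IN → Candidate ω x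
    nextIN⇒candidate ℓ>0 {x} x∈X nx with to next≡IN⇔ nx
    ... | stays sx ¬h = x∈X , inj₁ sx , dominates
      where
      dominates : Dominates ℕ._≤_ ω x
      dominates u xu su = ℕ.≮⇒≥ λ ℓx<ℓu →
        ¬h (hears⁺ xu (from (IN-sings (N⊆closedNbhd x∈X xu) (trans su sx) (ℓ x)) ℓx<ℓu)
                      (IN-silent-at-ℓ (X⊆closedNbhd x∈X) sx))
    ... | joins sx ¬h0 ¬h1 = x∈X , inj₂ (sx , noIN) , dominates
      where
      noIN : NoINNeighbour x
      noIN u xu su = ¬h0 (hears⁺ xu (from (IN-sings (N⊆closedNbhd x∈X xu) su 0) (ℓ>0 u))
                                     (UN-silent (X⊆closedNbhd x∈X) sx 0))
      dominates : Dominates ℕ._≤_ ω x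
      dominates u xu su = ℕ.≮⇒≥ λ ℓx<ℓu →
        ¬h1 (hears⁺ xu (from (UN-sings (N⊆closedNbhd x∈X xu) (trans su sx) (ℓ x)) ℓx<ℓu)
                       (UN-silent-at-ℓ (X⊆closedNbhd x∈X) sx))

    candidate⇒isolatedIN : Symmetric G → (∀ i → 0 ℕ.< ℓ i) → ∀ {x} → T (X x) → Eligible x →
      Dominates ℕ._<_ ω x → (G′ : Adj n) → (∀ v → G′ x v ≡ G x v) → T (inNotIn G′ next x)
    candidate⇒isolatedIN G-sym ℓ>0 {x} x∈X eligible dominates G′ G′≡G =
      from T-∧ (from isIN⇔ (from next≡IN⇔ (x-nextIN eligible)) , ¬T⇒T-not (no-IN-neighbour ∘ any-allFin⁻ _))
      where
      clx : T (closedNbhd G X x)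
      clx = X⊆closedNbhd x∈X
      cl : ∀ {u} → T (G x u) → T (closedNbhd G X u)
      cl = N⊆closedNbhd x∈X
      toward-x : ∀ {u} → T (G x u) → T (G u x)
      toward-x {u} xu = subst T (G-sym x u) xu

      x-nextIN : Eligible x → NextIN x
      x-nextIN (inj₁ sx) = stays sx (silence silent)
        where
        silent : ∀ u → T (G x u) → ¬ T (sings u (2 ℕ.* ℓ x))
        silent u xu = by-state (s u) refl
          where
          by-state : ∀ st → s u ≡ st → ¬ T (sings u (2 ℕ.* ℓ x))
          by-state OUT su = OUT-silent (cl xu) su _
          by-state UN  su = UN-silent (cl xu) su (ℓ x)
          by-state IN  su t =
            ℕ.<-asym (dominates u xu (trans su (sym sx))) (to (IN-sings (cl xu) su (ℓ x)) t)
      x-nextIN (inj₂ (sx , noIN)) = joins sx (silence silent-0) (silence silent-odd)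
        where
        silent-0 : ∀ u → T (G x u) → ¬ T (sings u 0)
        silent-0 u xu = by-state (s u) refl
          where
          by-state : ∀ st → s u ≡ st → ¬ T (sings u 0)
          by-state OUT su = OUT-silent (cl xu) su 0
          by-state UN  su = UN-silent (cl xu) su 0
          by-state IN  su = ⊥-elim (noIN u xu su)
        silent-odd : ∀ u → T (G x u) → ¬ T (sings u (2 ℕ.* ℓ x ℕ.+ 1))
        silent-odd u xu = by-state (s u) refl
          where
          by-state : ∀ st → s u ≡ st → ¬ T (sings u (2 ℕ.* ℓ x ℕ.+ 1))
          by-state OUT su = OUT-silent (cl xu) su _
          by-state UN  su t =
            ℕ.<-asym (dominates u xu (trans su (sym sx))) (to (UN-sings (cl xu) su (ℓ x)) t)
          by-state IN  su = ⊥-elim (noIN u xu su)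

      nbr-nextIN : Eligible x → ∀ u → T (G x u) → next u ≢ IN
      nbr-nextIN (inj₁ sx) u xu nu with to next≡IN⇔ nu
      ... | stays su ¬h =
        ¬h (hears⁺ (toward-x xu) (from (IN-sings clx sx (ℓ u)) (dominates u xu (trans su (sym sx))))
                   (IN-silent-at-ℓ (cl xu) su))
      ... | joins su ¬h0 _ =
        ¬h0 (hears⁺ (toward-x xu) (from (IN-sings clx sx 0) (ℓ>0 x)) (UN-silent (cl xu) su 0))
      nbr-nextIN (inj₂ (sx , noIN)) u xu nu with to next≡IN⇔ nu
      ... | stays su _ = noIN u xu su
      ... | joins su _ ¬h1 =
        ¬h1 (hears⁺ (toward-x xu) (from (UN-sings clx sx (ℓ u)) (dominates u xu (trans su (sym sx))))
                    (UN-silent-at-ℓ (cl xu) su))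

      no-IN-neighbour : ¬ ∃ λ u → T (G′ x u ∧ isIN (next u))
      no-IN-neighbour (u , t) with xu , uIN ← to T-∧ t =
        nbr-nextIN eligible u (subst T (G′≡G u) xu) (to isIN⇔ uIN)

module Coupling {n : ℕ} (G : Adj n) (s : Fin n → St) (X : Subset n) (ext : Fin n → ℕ → ℕ → Bool)
                (G-irr : Irreflexive G) where

  open Protocol G s X ext

  candidate? : ∀ ω x → Dec (Candidate ω x)
  candidate? ω x = T? (X x) ×-dec eligible? ×-dec dominates?
    where
    eligible? : Dec (Eligible x)
    eligible? = (s x ≟ₛ IN) ⊎-dec ((s x ≟ₛ UN) ×-dec Fin.all? λ u → T? (G x u) →-dec ¬? (s u ≟ₛ IN))
    dominates? : Dec (Dominates ℕ._≤_ ω x)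
    dominates? = Fin.all? λ u → T? (G x u) →-dec (s u ≟ₛ s x) →-dec (lookup ω u ℕ.≤? lookup ω x)

  candidate : Vec ℕ n → Fin n → Bool
  candidate ω x = ⌊ candidate? ω x ⌋

  candidate⇔ : ∀ ω x → T (candidate ω x) ⇔ Candidate ω x
  candidate⇔ ω x = mk⇔ (toWitness {a? = candidate? ω x}) fromWitness

  hasCandidate : Vec ℕ n → Bool
  hasCandidate ω = Maybe.is-just (first (candidate ω))

  bump : Vec ℕ n → Vec ℕ n
  bump ω = Maybe.maybe′ (λ x → ω [ x ]%= suc) ω (first (candidate ω))

  neighbour≢ : ∀ {x u} → T (G x u) → u ≢ x
  neighbour≢ {x} xu refl = subst T (G-irr x) xu

  bump-dominates : ∀ {ω x} → Dominates ℕ._≤_ ω x → Dominates ℕ._<_ (ω [ x ]%= suc) x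
  bump-dominates {ω} {x} dom u xu su = begin-strict
    lookup (ω [ x ]%= suc) u   ≡⟨ Vec.lookup∘updateAt′ u x (neighbour≢ xu) ω ⟩
    lookup ω u                 ≤⟨ dom u xu su ⟩
    lookup ω x                 <⟨ ℕ.n<1+n _ ⟩
    suc (lookup ω x)           ≡⟨ Vec.lookup∘updateAt x ω ⟨
    lookup (ω [ x ]%= suc) x   ∎
    where open ℕ.≤-Reasoning

  candidate-unbump : ∀ {ω x y} → y ≢ x → Candidate (ω [ x ]%= suc) y → Candidate ω y
  candidate-unbump {ω} {x} {y} y≢x (y∈X , eligible , dom) = y∈X , eligible , λ u yu su → begin
    lookup ω u                 ≤⟨ lookup-≤-updateAt-suc ω x u ⟩
    lookup (ω [ x ]%= suc) u   ≤⟨ dom u yu su ⟩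
    lookup (ω [ x ]%= suc) y   ≡⟨ Vec.lookup∘updateAt′ y x y≢x ω ⟩
    lookup ω y                 ∎
    where open ℕ.≤-Reasoning

  candidate-bump : ∀ {ω x} → Candidate ω x → Candidate (ω [ x ]%= suc) x
  candidate-bump {ω} (x∈X , eligible , dom) =
    x∈X , eligible , λ u xu su → ℕ.<⇒≤ (bump-dominates {ω} dom u xu su)

  first-candidate-bump : ∀ ω {x} → first (candidate ω) ≡ just x → first (candidate (ω [ x ]%= suc)) ≡ just x
  first-candidate-bump ω {x} e = first-transfer (candidate ω) (candidate (ω [ x ]%= suc)) e
    (from (candidate⇔ (ω [ x ]%= suc) x) (candidate-bump {ω} (to (candidate⇔ ω x) (first-sound (candidate ω) e))))
    (λ y y≢x cy → from (candidate⇔ ω y) (candidate-unbump {ω} y≢x (to (candidate⇔ (ω [ x ]%= suc) y) cy)))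

  hasCandidate⁻ : ∀ ω → T (hasCandidate ω) → ∃ λ x → first (candidate ω) ≡ just x
  hasCandidate⁻ ω t with first (candidate ω)
  ... | just x = x , refl

  bump-just : ∀ ω {x} → first (candidate ω) ≡ just x → bump ω ≡ ω [ x ]%= suc
  bump-just ω e rewrite e = refl

  truncatedCandidate : ℕ → Vec ℕ n → Bool
  truncatedCandidate K ω = hasCandidate ω ∧ below K ω

  below⊆eventB∪truncatedCandidate : ∀ {K ω} → ω ∈ box n K → T (below K ω) →
              T (Round.eventB G s X ext ω) ⊎ T (truncatedCandidate K ω)
  below⊆eventB∪truncatedCandidate {K} {ω} ω∈box below-ω with T? (Round.eventB G s X ext ω)
  ... | yes B = inj₁ B
  ... | no ¬B
    with x , ¬t ← ¬all-allFin⁻ _ ¬B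
    with x∈X , xIN ← to T-∧ (¬T-not⇒T ¬t)
    with y , e ← first-complete (candidate ω) (from (candidate⇔ ω x)
                   (nextIN⇒candidate ω (λ i → proj₁ (∈-box⁻ ω∈box i)) x∈X (to isIN⇔ xIN)))
    = inj₂ (from T-∧ (subst (T ∘ Maybe.is-just) (sym e) tt , below-ω))

  candidate-halving : Symmetric G → (G′ : Adj n) → (∀ x v → X x ≡ true → G′ x v ≡ G x v) → ∀ K →
    ½ * boxProb K (truncatedCandidate K) ≤ boxProb K (λ ω → Round.eventA G s X ext ω G′)
  candidate-halving G-sym G′ G′≡G K = boxProb-halving K (truncatedCandidate K) _ bump maps injective
    where
    Image : Vec ℕ n → Vec ℕ n → Set
    Image ω w = w ∈ box n K × T (Round.eventA G s X ext w G′) × Vec.sum w ≡ suc (Vec.sum ω)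

    maps : ∀ {ω} → ω ∈ box n K → T (truncatedCandidate K ω) → Image ω (bump ω)
    maps {ω} ω∈box C-ω
      with has , below-ω ← to T-∧ C-ω
      with x , e ← hasCandidate⁻ ω has
      with x∈X , eligible , dom ← to (candidate⇔ ω x) (first-sound (candidate ω) e) =
      subst (Image ω) (sym (bump-just ω e)) (bumped∈box , A-holds , sum-updateAt-suc ω x)
      where
      bumped∈box : ω [ x ]%= suc ∈ box n K
      bumped∈box = ∈-box⁺ (InBox-updateAt-suc {ω = ω} (∈-box⁻ ω∈box) (below⇒< {ω = ω} below-ω x))
      A-holds : T (Round.eventA G s X ext (ω [ x ]%= suc) G′)
      A-holds = any-allFin⁺ _ x (from T-∧ (x∈X ,
        candidate⇒isolatedIN (ω [ x ]%= suc) G-sym (λ i → proj₁ (∈-box⁻ bumped∈box i)) x∈X eligible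
          (bump-dominates {ω} dom) G′ (λ v → G′≡G x v (to T-≡ x∈X))))

    injective : ∀ {ω₁ ω₂} → ω₁ ∈ box n K → ω₂ ∈ box n K → T (truncatedCandidate K ω₁) →
                T (truncatedCandidate K ω₂) → bump ω₁ ≡ bump ω₂ → ω₁ ≡ ω₂
    injective {ω₁} {ω₂} _ _ C₁ C₂ bump≡
      with x₁ , e₁ ← hasCandidate⁻ ω₁ (proj₁ (to T-∧ C₁))
      with x₂ , e₂ ← hasCandidate⁻ ω₂ (proj₁ (to T-∧ C₂)) =
      updateAt-suc-injective ω₁ ω₂ x₁ (trans bumped≡ (cong (λ x → ω₂ [ x ]%= suc) (sym x₁≡x₂)))
      where
      bumped≡ : ω₁ [ x₁ ]%= suc ≡ ω₂ [ x₂ ]%= suc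
      bumped≡ = trans (sym (bump-just ω₁ e₁)) (trans bump≡ (bump-just ω₂ e₂))
      x₁≡x₂ : x₁ ≡ x₂
      x₁≡x₂ = just-injective (trans (sym (first-candidate-bump ω₁ e₁))
                (trans (cong (first ∘ candidate) bumped≡) (first-candidate-bump ω₂ e₂)))

lemma7 : ∀ (n : ℕ) (G G' : Adj n) → Symmetric G → Irreflexive G → Symmetric G' → Irreflexive G'
           → (s : Fin n → St) (ext : Fin n → ℕ → ℕ → Bool) (X : Subset n)
           → (∀ x → X x ≡ true → active G s x ≡ true)
           → (∀ u v → closedNbhd G X u ≡ true → closedNbhd G X v ≡ true → G' u v ≡ G u v)
           → (∀ x v → X x ≡ true → G' x v ≡ G x v)
           → ∀ (m : ℕ) → ∃ λ (K : ℕ) →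
               (1ℚ - boxProb K (λ lv → Round.eventB G s X ext lv)) * ½
                 ≤ boxProb K (λ lv → Round.eventA G s X ext lv G') + half^ m
-- Only the rows of G′ at agents of X enter the argument.
lemma7 n G G′ G-sym G-irr _ _ s ext X _ _ G′≡G m = K , (begin
  (1ℚ - pB) * ½              ≤⟨ *-monoʳ-≤-nonNeg ½ 1-pB≤ ⟩
  (half^ m + pC) * ½
    ≡⟨ solve 2 (λ h c → (h :+ c) :* con ½ := con ½ :* h :+ con ½ :* c) refl (half^ m) pC ⟩
  half^ (suc m) + ½ * pC     ≤⟨ +-mono-≤ (half^-suc-≤ m) (candidate-halving G-sym G′ G′≡G K) ⟩
  half^ m + pA               ≡⟨ +-comm (half^ m) pA ⟩
  pA + half^ m               ∎)
  where
  open ≤-Reasoning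
  open Coupling G s X ext G-irr
  K : ℕ
  K = suc (m ℕ.+ n)
  pA pB pC pBelow : ℚ
  pA = boxProb K (λ ω → Round.eventA G s X ext ω G′)
  pB = boxProb K (λ ω → Round.eventB G s X ext ω)
  pC = boxProb K (truncatedCandidate K)
  pBelow = boxProb {n} K (below K)
  1-pB≤ : 1ℚ - pB ≤ half^ m + pC
  1-pB≤ = begin
    1ℚ - pB
      ≡⟨ solve 2 (λ b q → con 1ℚ :- b := (con 1ℚ :- q) :+ (q :- b)) refl pB pBelow ⟩
    (1ℚ - pBelow) + (pBelow - pB)
      ≤⟨ +-mono-≤ (boxProb-below-tail n m)
                  (+-monoˡ-≤ (- pB) (boxProb-∪ K (below K) _ _ below⊆eventB∪truncatedCandidate)) ⟩
    half^ m + ((pB + pC) - pB)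
      ≡⟨ cong (half^ m +_) (solve 2 (λ b c → (b :+ c) :- b := c) refl pB pC) ⟩
    half^ m + pC
      ∎
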